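{- Let $(M,\le,0,1,+,\cdot,\exp)$ be a model of $T^{dc}_{\exp}$. Then $\exp$ is an increasing surjective map from $M$ onto $M^{>0}$ satisfying $\exp(x+y)=\exp(x)\exp(y)$ for all $x,y\in M$, and $\exp(x)\ge x+1$ for all $x\in M$.
   Context: $T^{dc}_{\exp}$ is the theory in the language $\{\le,0,1,+,\cdot,\exp\}$ whose models are exactly the definably complete structures $(M,\le,0,1,+,\cdot,\exp)$ (every nonempty definable-with-parameters subset bounded above has a least upper bound) such that $(M,\le,0,1,+,\cdot)$ is an ordered field and $\exp:M\to M$ is differentiable with $\exp'=\exp$ and $\exp(0)=1$. -}

module Defs where

open import Level using (0ℓ)
open import Data.Nat using (ℕ; suc)
open import Data.Fin using (Fin; zero; suc)
open import Data.Product using (Σ; _×_; _,_)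
open import Data.Sum using (_⊎_)
open import Data.Empty using (⊥)
open import Relation.Nullary using (¬_)
open import Relation.Binary.PropositionalEquality using (_≡_; _≢_)
open import Algebra.Structures using (IsCommutativeRing)

-- Equality is propositional equality; negation and inverse are
-- auxiliary (definable) operations, not symbols of the language.

record OrderedFieldExp : Set₁ where
  infixl 6 _+_
  infixl 7 _·_
  infix 4 _≤_
  field
    M    : Set
    _≤_  : M → M → Set
    𝟘 𝟙  : M
    _+_  : M → M → M
    _·_  : M → M → M
    exp  : M → M
    -_   : M → M
    _⁻¹  : M → M
    isCommutativeRing : IsCommutativeRing _≡_ _+_ _·_ -_ 𝟘 𝟙
    𝟘≢𝟙     : 𝟘 ≢ 𝟙
    ⁻¹-inverse : ∀ x → x ≢ 𝟘 → x · (x ⁻¹) ≡ 𝟙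
    ≤-refl    : ∀ x → x ≤ x
    ≤-antisym : ∀ {x y} → x ≤ y → y ≤ x → x ≡ y
    ≤-trans   : ∀ {x y z} → x ≤ y → y ≤ z → x ≤ z
    ≤-total   : ∀ x y → (x ≤ y) ⊎ (y ≤ x)
    +-mono-≤  : ∀ {x y} z → x ≤ y → x + z ≤ y + z
    ·-nonneg  : ∀ {x y} → 𝟘 ≤ x → 𝟘 ≤ y → 𝟘 ≤ x · y

  infix 4 _<_
  _<_ : M → M → Set
  x < y = (x ≤ y) × (x ≢ y)

  _-_ : M → M → M
  x - y = x + (- y)

  ∣_∣ : M → M
  ∣ x ∣ with ≤-total 𝟘 x
  ... | Data.Sum.inj₁ _ = x
  ... | Data.Sum.inj₂ _ = - x

-- First-order language {≤,0,1,+,·,exp} with parameters from M.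
-- Terms/formulas in n free variables (de Bruijn indices).

module Language (S : OrderedFieldExp) where
  open OrderedFieldExp S

  data Term (n : ℕ) : Set where
    var   : Fin n → Term n
    param : M → Term n
    t0 t1 : Term n
    _⊕_   : Term n → Term n → Term n
    _⊗_   : Term n → Term n → Term n
    texp  : Term n → Term n

  data Formula (n : ℕ) : Set where
    _≐_  _≼_ : Term n → Term n → Formula n
    ff       : Formula n
    _⇒_ _∧'_ _∨'_ : Formula n → Formula n → Formula n
    ∀' ∃'    : Formula (suc n) → Formula n

  Env : ℕ → Set
  Env n = Fin n → M

  extend : ∀ {n} → M → Env n → Env (suc n)
  extend a ρ zero    = a
  extend a ρ (suc i) = ρ i

  ⟦_⟧ₜ : ∀ {n} → Term n → Env n → M
  ⟦ var i ⟧ₜ ρ   = ρ i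
  ⟦ param a ⟧ₜ ρ = a
  ⟦ t0 ⟧ₜ ρ      = 𝟘
  ⟦ t1 ⟧ₜ ρ      = 𝟙
  ⟦ s ⊕ t ⟧ₜ ρ   = ⟦ s ⟧ₜ ρ + ⟦ t ⟧ₜ ρ
  ⟦ s ⊗ t ⟧ₜ ρ   = ⟦ s ⟧ₜ ρ · ⟦ t ⟧ₜ ρ
  ⟦ texp t ⟧ₜ ρ  = exp (⟦ t ⟧ₜ ρ)

  _⊨_ : ∀ {n} → Env n → Formula n → Set
  ρ ⊨ (s ≐ t)  = ⟦ s ⟧ₜ ρ ≡ ⟦ t ⟧ₜ ρ
  ρ ⊨ (s ≼ t)  = ⟦ s ⟧ₜ ρ ≤ ⟦ t ⟧ₜ ρ
  ρ ⊨ ff       = ⊥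
  ρ ⊨ (φ ⇒ ψ)  = ρ ⊨ φ → ρ ⊨ ψ
  ρ ⊨ (φ ∧' ψ) = ρ ⊨ φ × ρ ⊨ ψ
  ρ ⊨ (φ ∨' ψ) = ρ ⊨ φ ⊎ ρ ⊨ ψ
  ρ ⊨ ∀' φ     = (a : M) → extend a ρ ⊨ φ
  ρ ⊨ ∃' φ     = Σ M λ a → extend a ρ ⊨ φ

  _∈⟦_⟧ : M → Formula 1 → Set
  a ∈⟦ φ ⟧ = extend a (λ ()) ⊨ φ

module _ (S : OrderedFieldExp) where
  open OrderedFieldExp S
  open Language S

  DefinablyComplete : Set
  DefinablyComplete =
    (φ : Formula 1) →
    Σ M (λ a → a ∈⟦ φ ⟧) →
    Σ M (λ b → ∀ x → x ∈⟦ φ ⟧ → x ≤ b) →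
    Σ M λ s → (∀ x → x ∈⟦ φ ⟧ → x ≤ s)
             × (∀ b → (∀ x → x ∈⟦ φ ⟧ → x ≤ b) → s ≤ b)

  HasDerivativeAt : (M → M) → M → M → Set
  HasDerivativeAt f a d =
    ∀ ε → 𝟘 < ε → Σ M λ δ → (𝟘 < δ) ×
      (∀ h → 𝟘 < ∣ h ∣ → ∣ h ∣ < δ →
         ∣ ((f (a + h) - f a) · (h ⁻¹)) - d ∣ < ε)

  IsModelTdcExp : Set
  IsModelTdcExp =
    DefinablyComplete
    × (∀ a → HasDerivativeAt exp a (exp a))
    × (exp 𝟘 ≡ 𝟙)

-- Definable completeness gives, for functions computed by terms, the interval arguments of
-- real analysis. If f is locally increasing at every point of [a, b], the supremum of the
-- x ∈ [a, b] with f ≥ f a on [a, x] must be b, so f a < f b; tilting f by a small linear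
-- term then shows that a nonnegative derivative makes f monotone, and a zero derivative
-- makes it constant. Applied to exp: x ↦ exp x · exp (c - x) has derivative 0, whence
-- exp (x + y) = exp x · exp y and exp x ≠ 0; so exp x = exp (x / 2)² > 0 and exp is
-- increasing; exp x - x has derivative exp x - 1, of the sign of x, so it is least at 0;
-- and by continuity of exp the supremum of {x | exp x ≤ y} is a preimage of y > 0.

module Submission where

open import Defs
open import Level using (0ℓ)
open import Algebra.Bundles using (CommutativeRing)
open import Algebra.Solver.Ring.AlmostCommutativeRing using (fromCommutativeRing; _-Raw-AlmostCommutative⟶_)
open import Axiom.ExcludedMiddle using (ExcludedMiddle)
open import Axiom.DoubleNegationElimination using (em⇒dne)
open import Data.Empty using (⊥)
open import Data.Fin using (zero; suc)
open import Data.Integer.Base as ℤ using (ℤ; +_; -[1+_])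
import Data.Integer.Properties as ℤ
open import Data.Maybe.Base using (Maybe; just; nothing)
open import Data.Nat.Base as ℕ using (zero; suc)
import Data.Nat.Properties as ℕ
open import Data.Product using (Σ; _×_; _,_; proj₁; proj₂)
open import Data.Sign.Base as Sign using (Sign)
open import Data.Sum using (_⊎_; inj₁; inj₂; [_,_]′)
open import Function using (_∘_; id; const)
open import Relation.Nullary using (¬_; yes; no; contradiction)
open import Relation.Binary.PropositionalEquality
  using (_≡_; _≢_; refl; sym; trans; cong; cong₂; subst; subst₂; module ≡-Reasoning)
import Relation.Binary.PropositionalEquality as ≡

-- The library's ring solvers for a given ring use that ring as coefficients and must decide
-- when a coefficient vanishes, which is impossible in an abstract ring; integer coefficients can.
module IntegerCoefficientRingSolver {c ℓ} (R : CommutativeRing c ℓ) where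

  open CommutativeRing R hiding (refl; sym; trans)
  open CommutativeRing R using () renaming (refl to ≈-refl; sym to ≈-sym; trans to ≈-trans)
  open import Algebra.Properties.Ring ring using (-0#≈0#; -‿involutive; -‿distribˡ-*)
  open import Algebra.Properties.AbelianGroup +-abelianGroup using (⁻¹-∙-comm)
  open import Algebra.Properties.CommutativeSemigroup +-commutativeSemigroup
    using () renaming (interchange to +-interchange)
  open import Algebra.Properties.CommutativeSemigroup *-commutativeSemigroup
    using () renaming (interchange to *-interchange)
  open import Algebra.Properties.Semiring.Mult.TCOptimised semiring
    using (1+×; ×-homo-+; ×1-homo-*) renaming (_×_ to _×′_)
  open import Relation.Binary.Reasoning.Setoid setoid

  -- With the type-checking-optimised `_×_`, `fromℤ (+ 1)` reduces to `1#`, so `con (+ 1)`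
  -- stands for 1# in solver goals.
  fromℤ : ℤ → Carrier
  fromℤ (+ n)    = n ×′ 1#
  fromℤ -[1+ n ] = - (suc n ×′ 1#)

  private
    1+x-[1+y]≈x-y : ∀ x y → (1# + x) - (1# + y) ≈ x - y
    1+x-[1+y]≈x-y x y = begin
      (1# + x) + - (1# + y)      ≈⟨ +-congˡ (⁻¹-∙-comm 1# y) ⟨
      (1# + x) + (- 1# + - y)    ≈⟨ +-interchange 1# x (- 1#) (- y) ⟩
      (1# + - 1#) + (x - y)      ≈⟨ +-congʳ (-‿inverseʳ 1#) ⟩
      0# + (x - y)               ≈⟨ +-identityˡ (x - y) ⟩
      x - y                      ∎

    fromℤ-⊖ : ∀ m n → fromℤ (m ℤ.⊖ n) ≈ m ×′ 1# - n ×′ 1#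
    fromℤ-⊖ zero    zero    = ≈-sym (≈-trans (+-identityˡ (- 0#)) -0#≈0#)
    fromℤ-⊖ zero    (suc n) = ≈-sym (+-identityˡ _)
    fromℤ-⊖ (suc m) zero    = ≈-sym (≈-trans (+-congˡ -0#≈0#) (+-identityʳ _))
    fromℤ-⊖ (suc m) (suc n) = begin
      fromℤ (suc m ℤ.⊖ suc n)           ≡⟨ ≡.cong fromℤ (ℤ.[1+m]⊖[1+n]≡m⊖n m n) ⟩
      fromℤ (m ℤ.⊖ n)                   ≈⟨ fromℤ-⊖ m n ⟩
      m ×′ 1# - n ×′ 1#                 ≈⟨ 1+x-[1+y]≈x-y (m ×′ 1#) (n ×′ 1#) ⟨
      (1# + m ×′ 1#) - (1# + n ×′ 1#)   ≈⟨ +-cong (1+× m 1#) (-‿cong (1+× n 1#)) ⟨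
      suc m ×′ 1# - suc n ×′ 1#         ∎

    fromℤ-+ : ∀ i j → fromℤ (i ℤ.+ j) ≈ fromℤ i + fromℤ j
    fromℤ-+ -[1+ m ] -[1+ n ] = begin
      - (suc (suc (m ℕ.+ n)) ×′ 1#)       ≡⟨ ≡.cong (λ k → - (suc k ×′ 1#)) (ℕ.+-suc m n) ⟨
      - ((suc m ℕ.+ suc n) ×′ 1#)         ≈⟨ -‿cong (×-homo-+ 1# (suc m) (suc n)) ⟩
      - (suc m ×′ 1# + suc n ×′ 1#)       ≈⟨ ⁻¹-∙-comm _ _ ⟨
      - (suc m ×′ 1#) + - (suc n ×′ 1#)   ∎
    fromℤ-+ -[1+ m ] (+ n)    = ≈-trans (fromℤ-⊖ n (suc m)) (+-comm _ _)
    fromℤ-+ (+ m)    -[1+ n ] = fromℤ-⊖ m (suc n)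
    fromℤ-+ (+ m)    (+ n)    = ×-homo-+ 1# m n

    sign : Sign → Carrier
    sign Sign.+ = 1#
    sign Sign.- = - 1#

    fromℤ-◃ : ∀ s n → fromℤ (s ℤ.◃ n) ≈ sign s * (n ×′ 1#)
    fromℤ-◃ s       zero    = ≈-sym (zeroʳ _)
    fromℤ-◃ Sign.+  (suc n) = ≈-sym (*-identityˡ _)
    fromℤ-◃ Sign.-  (suc n) = ≈-trans (-‿cong (≈-sym (*-identityˡ _))) (-‿distribˡ-* _ _)

    sign-* : ∀ s t → sign (s Sign.* t) ≈ sign s * sign t
    sign-* Sign.- Sign.- = ≈-sym (begin
      - 1# * - 1#       ≈⟨ -‿distribˡ-* 1# (- 1#) ⟨
      - (1# * - 1#)     ≈⟨ -‿cong (*-identityˡ (- 1#)) ⟩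
      - - 1#            ≈⟨ -‿involutive 1# ⟩
      1#                ∎)
    sign-* Sign.- Sign.+ = ≈-sym (*-identityʳ _)
    sign-* Sign.+ Sign.- = ≈-sym (*-identityˡ _)
    sign-* Sign.+ Sign.+ = ≈-sym (*-identityˡ _)

    fromℤ-* : ∀ i j → fromℤ (i ℤ.* j) ≈ fromℤ i * fromℤ j
    fromℤ-* i j = begin
      fromℤ (sᵢ Sign.* sⱼ ℤ.◃ ∣i∣ ℕ.* ∣j∣)            ≈⟨ fromℤ-◃ (sᵢ Sign.* sⱼ) (∣i∣ ℕ.* ∣j∣) ⟩
      sign (sᵢ Sign.* sⱼ) * ((∣i∣ ℕ.* ∣j∣) ×′ 1#)      ≈⟨ *-cong (sign-* sᵢ sⱼ) (×1-homo-* ∣i∣ ∣j∣) ⟩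
      (sign sᵢ * sign sⱼ) * ((∣i∣ ×′ 1#) * (∣j∣ ×′ 1#)) ≈⟨ *-interchange _ _ _ _ ⟩
      (sign sᵢ * (∣i∣ ×′ 1#)) * (sign sⱼ * (∣j∣ ×′ 1#)) ≈⟨ *-cong (fromℤ-◃ sᵢ ∣i∣) (fromℤ-◃ sⱼ ∣j∣) ⟨
      fromℤ (sᵢ ℤ.◃ ∣i∣) * fromℤ (sⱼ ℤ.◃ ∣j∣)         ≡⟨ ≡.cong₂ (λ u v → fromℤ u * fromℤ v) (ℤ.◃-inverse i) (ℤ.◃-inverse j) ⟩
      fromℤ i * fromℤ j                               ∎
      where
      sᵢ = ℤ.sign i
      sⱼ = ℤ.sign j
      ∣i∣ = ℤ.∣ i ∣
      ∣j∣ = ℤ.∣ j ∣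

    fromℤ-neg : ∀ i → fromℤ (ℤ.- i) ≈ - fromℤ i
    fromℤ-neg (+ zero)  = ≈-sym -0#≈0#
    fromℤ-neg (+ suc n) = ≈-refl
    fromℤ-neg -[1+ n ]  = ≈-sym (-‿involutive _)

    fromℤ-homomorphism : ℤ.+-*-rawRing -Raw-AlmostCommutative⟶ fromCommutativeRing R
    fromℤ-homomorphism = record
      { ⟦_⟧ = fromℤ ; +-homo = fromℤ-+ ; *-homo = fromℤ-* ; -‿homo = fromℤ-neg
      ; 0-homo = ≈-refl ; 1-homo = ≈-refl }

    fromℤ-≟ : ∀ i j → Maybe (fromℤ i ≈ fromℤ j)
    fromℤ-≟ i j with i ℤ.≟ j
    ... | yes i≡j = just (reflexive (≡.cong fromℤ i≡j))
    ... | no _    = nothing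

  open import Algebra.Solver.Ring ℤ.+-*-rawRing (fromCommutativeRing R) fromℤ-homomorphism fromℤ-≟ public

module OrderedFieldProperties (S : OrderedFieldExp) where

  open OrderedFieldExp S public hiding (_-_) renaming (+-mono-≤ to +-monoˡ-≤)

  commutativeRing : CommutativeRing 0ℓ 0ℓ
  commutativeRing = record { isCommutativeRing = isCommutativeRing }

  open CommutativeRing commutativeRing public
    using (_-_; +-comm; *-assoc; +-identityˡ; +-identityʳ; -‿inverseʳ; *-comm; *-identityˡ; *-identityʳ; zeroˡ; zeroʳ)
  open import Algebra.Properties.Ring (CommutativeRing.ring commutativeRing) public
    using (-0#≈0#; -‿involutive)
  open IntegerCoefficientRingSolver commutativeRing public
    using (solve; _:=_; _:+_; _:*_; _:-_; :-_; con)

  private variable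
    x y z w x′ y′ : M

  -- A strict order that is a negation, so it composes without case analysis;
  -- it agrees with `_<_` by `<⇒≺` and `≺⇒<`.
  infix 4 _≺_
  _≺_ : M → M → Set
  x ≺ y = ¬ (y ≤ x)

  ≤-reflexive : x ≡ y → x ≤ y
  ≤-reflexive refl = ≤-refl _

  ≺⇒≤ : x ≺ y → x ≤ y
  ≺⇒≤ {x} {y} x≺y with ≤-total x y
  ... | inj₁ x≤y = x≤y
  ... | inj₂ y≤x = contradiction y≤x x≺y

  module ≤-Reasoning where
    open import Relation.Binary.Reasoning.Base.Single _≤_ (≤-refl _) ≤-trans public
    open import Relation.Binary.Reasoning.Syntax using (module ≤-syntax)
    open ≤-syntax _IsRelatedTo_ _IsRelatedTo_ ∼-go public

  ≺-irrefl : ¬ x ≺ x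
  ≺-irrefl x≺x = x≺x (≤-refl _)

  ≺-≤-trans : x ≺ y → y ≤ z → x ≺ z
  ≺-≤-trans x≺y y≤z z≤x = x≺y (≤-trans y≤z z≤x)

  ≤-≺-trans : x ≤ y → y ≺ z → x ≺ z
  ≤-≺-trans x≤y y≺z z≤x = y≺z (≤-trans z≤x x≤y)

  ≺-trans : x ≺ y → y ≺ z → x ≺ z
  ≺-trans x≺y y≺z = ≺-≤-trans x≺y (≺⇒≤ y≺z)

  ≺⇒≢ : x ≺ y → x ≢ y
  ≺⇒≢ x≺x refl = ≺-irrefl x≺x

  ≤∧≢⇒≺ : x ≤ y → x ≢ y → x ≺ y
  ≤∧≢⇒≺ x≤y x≢y y≤x = x≢y (≤-antisym x≤y y≤x)

  <⇒≺ : x < y → x ≺ y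
  <⇒≺ (x≤y , x≢y) = ≤∧≢⇒≺ x≤y x≢y

  ≺⇒< : x ≺ y → x < y
  ≺⇒< x≺y = ≺⇒≤ x≺y , ≺⇒≢ x≺y

  x≤y⇒0≤y-x : x ≤ y → 𝟘 ≤ y - x
  x≤y⇒0≤y-x {x} {y} x≤y = subst (_≤ y - x) (-‿inverseʳ x) (+-monoˡ-≤ (- x) x≤y)

  0≤y-x⇒x≤y : 𝟘 ≤ y - x → x ≤ y
  0≤y-x⇒x≤y {y} {x} 0≤y-x = subst₂ _≤_ (+-identityˡ x) (cancel y x) (+-monoˡ-≤ x 0≤y-x)
    where
    cancel : ∀ y x → y - x + x ≡ y
    cancel = solve 2 (λ y x → y :- x :+ x := y) refl

  -- Most order facts below are reduced to one of these two by a ring identity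
  -- between the differences of the two sides.
  ≤-by-difference : y′ - x′ ≡ y - x → x ≤ y → x′ ≤ y′
  ≤-by-difference eq x≤y = 0≤y-x⇒x≤y (subst (𝟘 ≤_) (sym eq) (x≤y⇒0≤y-x x≤y))

  ≺-by-difference : y′ - x′ ≡ y - x → x ≺ y → x′ ≺ y′
  ≺-by-difference {y′} {x′} {y} {x} eq x≺y y′≤x′ = x≺y (≤-by-difference (begin
    x - y        ≡⟨ swap y x ⟩
    - (y - x)    ≡⟨ cong -_ eq ⟨
    - (y′ - x′)  ≡⟨ swap y′ x′ ⟨
    x′ - y′      ∎) y′≤x′)
    where
    open ≡-Reasoning
    swap : ∀ y x → x - y ≡ - (y - x)
    swap = solve 2 (λ y x → x :- y := :- (y :- x)) refl

  x≺y⇒0≺y-x : x ≺ y → 𝟘 ≺ y - x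
  x≺y⇒0≺y-x {x} {y} = ≺-by-difference (solve 2 (λ x y → y :- x :- con (+ 0) := y :- x) refl x y)

  +-monoʳ-≤ : ∀ z → x ≤ y → z + x ≤ z + y
  +-monoʳ-≤ {x} {y} z = ≤-by-difference (solve 3 (λ z x y → z :+ y :- (z :+ x) := y :- x) refl z x y)

  +-mono-≤ : x ≤ y → z ≤ w → x + z ≤ y + w
  +-mono-≤ {y = y} {z = z} x≤y z≤w = ≤-trans (+-monoˡ-≤ z x≤y) (+-monoʳ-≤ y z≤w)

  +-monoʳ-≺ : ∀ z → x ≺ y → z + x ≺ z + y
  +-monoʳ-≺ {x} {y} z = ≺-by-difference (solve 3 (λ z x y → z :+ y :- (z :+ x) := y :- x) refl z x y)

  +-mono-≤-≺ : x ≤ y → z ≺ w → x + z ≺ y + w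
  +-mono-≤-≺ {y = y} {z = z} x≤y z≺w = ≤-≺-trans (+-monoˡ-≤ z x≤y) (+-monoʳ-≺ y z≺w)

  neg-antimono-≤ : x ≤ y → - y ≤ - x
  neg-antimono-≤ {x} {y} = ≤-by-difference (solve 2 (λ x y → :- x :- :- y := y :- x) refl x y)

  neg-antimono-≺ : x ≺ y → - y ≺ - x
  neg-antimono-≺ {x} {y} = ≺-by-difference (solve 2 (λ x y → :- x :- :- y := y :- x) refl x y)

  x≤0⇒0≤-x : x ≤ 𝟘 → 𝟘 ≤ - x
  x≤0⇒0≤-x x≤0 = subst (_≤ _) -0#≈0# (neg-antimono-≤ x≤0)

  0≤x⇒-x≤0 : 𝟘 ≤ x → - x ≤ 𝟘
  0≤x⇒-x≤0 0≤x = subst (_ ≤_) -0#≈0# (neg-antimono-≤ 0≤x)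

  0≺x⇒-x≺0 : 𝟘 ≺ x → - x ≺ 𝟘
  0≺x⇒-x≺0 0≺x = subst (_ ≺_) -0#≈0# (neg-antimono-≺ 0≺x)

  x-[x-y]≡y : ∀ x y → x - (x - y) ≡ y
  x-[x-y]≡y = solve 2 (λ x y → x :- (x :- y) := y) refl

  x+[y-x]≡y : ∀ x y → x + (y - x) ≡ y
  x+[y-x]≡y = solve 2 (λ x y → x :+ (y :- x) := y) refl

  x-z≺y⇒x-y≺z : x - z ≺ y → x - y ≺ z
  x-z≺y⇒x-y≺z {x} {z} {y} = ≺-by-difference (solve 3 (λ x y z → z :- (x :- y) := y :- (x :- z)) refl x y z)

  y≺x+z⇒y-x≺z : y ≺ x + z → y - x ≺ z
  y≺x+z⇒y-x≺z {y} {x} {z} = ≺-by-difference (solve 3 (λ x y z → z :- (y :- x) := x :+ z :- y) refl x y z)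

  x≺x+y : 𝟘 ≺ y → x ≺ x + y
  x≺x+y {y} {x} 0≺y = ≺-by-difference (solve 2 (λ x y → x :+ y :- x := y :- con (+ 0)) refl x y) 0≺y

  x-y≺x : 𝟘 ≺ y → x - y ≺ x
  x-y≺x {y} {x} 0≺y = ≺-by-difference (solve 2 (λ x y → x :- (x :- y) := y :- con (+ 0)) refl x y) 0≺y

  x≤x+y : 𝟘 ≤ y → x ≤ x + y
  x≤x+y {y} {x} 0≤y = ≤-by-difference (solve 2 (λ x y → x :+ y :- x := y :- con (+ 0)) refl x y) 0≤y

  x-y≤x : 𝟘 ≤ y → x - y ≤ x
  x-y≤x {y} {x} 0≤y = ≤-by-difference (solve 2 (λ x y → x :- (x :- y) := y :- con (+ 0)) refl x y) 0≤y

  0≤x+y : 𝟘 ≤ x → 𝟘 ≤ y → 𝟘 ≤ x + y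
  0≤x+y 0≤x 0≤y = subst (_≤ _) (+-identityʳ 𝟘) (+-mono-≤ 0≤x 0≤y)

  0≺x+y : 𝟘 ≤ x → 𝟘 ≺ y → 𝟘 ≺ x + y
  0≺x+y 0≤x 0≺y = subst (_≺ _) (+-identityʳ 𝟘) (+-mono-≤-≺ 0≤x 0≺y)

  *-monoˡ-≤-nonNeg : 𝟘 ≤ z → x ≤ y → x · z ≤ y · z
  *-monoˡ-≤-nonNeg {z} {x} {y} 0≤z x≤y = ≤-by-difference
    (solve 3 (λ z x y → y :* z :- x :* z := (y :- x) :* z :- con (+ 0)) refl z x y)
    (·-nonneg (x≤y⇒0≤y-x x≤y) 0≤z)

  *-monoʳ-≤-nonNeg : 𝟘 ≤ z → x ≤ y → z · x ≤ z · y
  *-monoʳ-≤-nonNeg {z} {x} {y} 0≤z x≤y = subst₂ _≤_ (*-comm x z) (*-comm y z) (*-monoˡ-≤-nonNeg 0≤z x≤y)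

  *-mono-≤-nonNeg : 𝟘 ≤ x → 𝟘 ≤ z → x ≤ y → z ≤ w → x · z ≤ y · w
  *-mono-≤-nonNeg {y = y} 0≤x 0≤z x≤y z≤w =
    ≤-trans (*-monoˡ-≤-nonNeg 0≤z x≤y) (*-monoʳ-≤-nonNeg (≤-trans 0≤x x≤y) z≤w)

  x·x-nonNeg : ∀ x → 𝟘 ≤ x · x
  x·x-nonNeg x with ≤-total 𝟘 x
  ... | inj₁ 0≤x = ·-nonneg 0≤x 0≤x
  ... | inj₂ x≤0 = subst (𝟘 ≤_) (solve 1 (λ x → :- x :* :- x := x :* x) refl x)
                         (·-nonneg (x≤0⇒0≤-x x≤0) (x≤0⇒0≤-x x≤0))

  0≤1 : 𝟘 ≤ 𝟙
  0≤1 = subst (𝟘 ≤_) (*-identityˡ 𝟙) (x·x-nonNeg 𝟙)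

  0≺1 : 𝟘 ≺ 𝟙
  0≺1 1≤0 = 𝟘≢𝟙 (≤-antisym 0≤1 1≤0)

  0≤x⇒0≺x+1 : 𝟘 ≤ x → 𝟘 ≺ x + 𝟙
  0≤x⇒0≺x+1 0≤x = ≤-≺-trans 0≤x (x≺x+y 0≺1)

  ⁻¹-inverseˡ : x ≢ 𝟘 → x ⁻¹ · x ≡ 𝟙
  ⁻¹-inverseˡ {x} x≢0 = trans (*-comm (x ⁻¹) x) (⁻¹-inverse x x≢0)

  0≺⇒≢0 : 𝟘 ≺ x → x ≢ 𝟘
  0≺⇒≢0 0≺x x≡0 = 0≺x (≤-reflexive x≡0)

  x·y≡0⇒y≡0 : x ≢ 𝟘 → x · y ≡ 𝟘 → y ≡ 𝟘
  x·y≡0⇒y≡0 {x} {y} x≢0 xy≡0 = begin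
    y                ≡⟨ *-identityˡ y ⟨
    𝟙 · y            ≡⟨ cong (_· y) (⁻¹-inverseˡ x≢0) ⟨
    x ⁻¹ · x · y     ≡⟨ *-assoc (x ⁻¹) x y ⟩
    x ⁻¹ · (x · y)   ≡⟨ cong (x ⁻¹ ·_) xy≡0 ⟩
    x ⁻¹ · 𝟘         ≡⟨ zeroʳ (x ⁻¹) ⟩
    𝟘                ∎
    where open ≡-Reasoning

  *-pos : 𝟘 ≺ x → 𝟘 ≺ y → 𝟘 ≺ x · y
  *-pos 0≺x 0≺y xy≤0 =
    0≺⇒≢0 0≺y (x·y≡0⇒y≡0 (0≺⇒≢0 0≺x) (≤-antisym xy≤0 (·-nonneg (≺⇒≤ 0≺x) (≺⇒≤ 0≺y))))

  ⁻¹-pos : 𝟘 ≺ x → 𝟘 ≺ x ⁻¹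
  ⁻¹-pos {x} 0≺x x⁻¹≤0 =
    0≺1 (subst₂ _≤_ (⁻¹-inverseˡ (0≺⇒≢0 0≺x)) (zeroˡ x) (*-monoˡ-≤-nonNeg (≺⇒≤ 0≺x) x⁻¹≤0))

  x·y⁻¹·y≡x : 𝟘 ≺ y → x · y ⁻¹ · y ≡ x
  x·y⁻¹·y≡x {y} {x} 0≺y = begin
    x · y ⁻¹ · y     ≡⟨ *-assoc x (y ⁻¹) y ⟩
    x · (y ⁻¹ · y)   ≡⟨ cong (x ·_) (⁻¹-inverseˡ (0≺⇒≢0 0≺y)) ⟩
    x · 𝟙            ≡⟨ *-identityʳ x ⟩
    x                ∎
    where open ≡-Reasoning

  x≤y·z⁻¹⇒x·z≤y : 𝟘 ≺ z → x ≤ y · z ⁻¹ → x · z ≤ y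
  x≤y·z⁻¹⇒x·z≤y 0≺z x≤y/z = subst (_ ≤_) (x·y⁻¹·y≡x 0≺z) (*-monoˡ-≤-nonNeg (≺⇒≤ 0≺z) x≤y/z)

  half : M
  half = (𝟙 + 𝟙) ⁻¹

  0≺1+1 : 𝟘 ≺ 𝟙 + 𝟙
  0≺1+1 = ≺-trans 0≺1 (x≺x+y 0≺1)

  half-pos : 𝟘 ≺ x → 𝟘 ≺ half · x
  half-pos = *-pos (⁻¹-pos 0≺1+1)

  half+half : ∀ x → half · x + half · x ≡ x
  half+half x = trans (solve 2 (λ h x → h :* x :+ h :* x := x :* h :* (con (+ 1) :+ con (+ 1))) refl half x)
                      (x·y⁻¹·y≡x 0≺1+1)

  half≺ : 𝟘 ≺ x → half · x ≺ x
  half≺ {x} 0≺x = subst (half · x ≺_) (half+half x) (x≺x+y (half-pos 0≺x))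

  infixl 7 _⊓_
  _⊓_ : M → M → M
  x ⊓ y = [ const x , const y ]′ (≤-total x y)

  x⊓y≤x : ∀ x y → x ⊓ y ≤ x
  x⊓y≤x x y with ≤-total x y
  ... | inj₁ _   = ≤-refl x
  ... | inj₂ y≤x = y≤x

  x⊓y≤y : ∀ x y → x ⊓ y ≤ y
  x⊓y≤y x y with ≤-total x y
  ... | inj₁ x≤y = x≤y
  ... | inj₂ _   = ≤-refl y

  ⊓-pos : 𝟘 ≺ x → 𝟘 ≺ y → 𝟘 ≺ x ⊓ y
  ⊓-pos {x} {y} 0≺x 0≺y with ≤-total x y
  ... | inj₁ _ = 0≺x
  ... | inj₂ _ = 0≺y

  -- `x ∈± e` is `∣ x ∣ ≤ e` without the case split hidden in `∣_∣`.
  infix 4 _∈±_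
  _∈±_ : M → M → Set
  x ∈± e = (x ≤ e) × (- e ≤ x)

  ∈±-neg : x ∈± z → - x ∈± z
  ∈±-neg {x} {z} (x≤z , -z≤x) = subst (- x ≤_) (-‿involutive z) (neg-antimono-≤ -z≤x) , neg-antimono-≤ x≤z

  ∈±-neg⁻¹ : - x ∈± z → x ∈± z
  ∈±-neg⁻¹ {x} {z} b = subst (_∈± z) (-‿involutive x) (∈±-neg b)

  ∈±-mono : x ∈± y → y ≤ z → x ∈± z
  ∈±-mono (x≤y , -y≤x) y≤z = ≤-trans x≤y y≤z , ≤-trans (neg-antimono-≤ y≤z) -y≤x

  ∈±-nonNeg : x ∈± z → 𝟘 ≤ z
  ∈±-nonNeg {x} {z} (x≤z , -z≤x) with ≤-total 𝟘 z
  ... | inj₁ 0≤z = 0≤z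
  ... | inj₂ z≤0 = ≤-trans (x≤0⇒0≤-x z≤0) (≤-trans -z≤x x≤z)

  ∈±-self : 𝟘 ≤ x → x ∈± x
  ∈±-self 0≤x = ≤-refl _ , ≤-trans (0≤x⇒-x≤0 0≤x) 0≤x

  ∈±-+ : x ∈± z → y ∈± w → x + y ∈± z + w
  ∈±-+ {x} {z} {y} {w} (x≤z , -z≤x) (y≤w , -w≤y) =
    +-mono-≤ x≤z y≤w , subst (_≤ x + y) (solve 2 (λ z w → :- z :+ :- w := :- (z :+ w)) refl z w) (+-mono-≤ -z≤x -w≤y)

  private
    ∈±-*-nonNeg : 𝟘 ≤ x → 𝟘 ≤ y → x ≤ z → y ≤ w → x · y ∈± z · w
    ∈±-*-nonNeg 0≤x 0≤y x≤z y≤w =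
      *-mono-≤-nonNeg 0≤x 0≤y x≤z y≤w ,
      ≤-trans (0≤x⇒-x≤0 (·-nonneg (≤-trans 0≤x x≤z) (≤-trans 0≤y y≤w))) (·-nonneg 0≤x 0≤y)

  ∈±-* : x ∈± z → y ∈± w → x · y ∈± z · w
  ∈±-* {x} {z} {y} {w} bx by with ≤-total 𝟘 x | ≤-total 𝟘 y
  ... | inj₁ 0≤x | inj₁ 0≤y = ∈±-*-nonNeg 0≤x 0≤y (proj₁ bx) (proj₁ by)
  ... | inj₁ 0≤x | inj₂ y≤0 = ∈±-neg⁻¹ (subst (_∈± z · w) (solve 2 (λ x y → x :* :- y := :- (x :* y)) refl x y)
    (∈±-*-nonNeg 0≤x (x≤0⇒0≤-x y≤0) (proj₁ bx) (proj₁ (∈±-neg by))))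
  ... | inj₂ x≤0 | inj₁ 0≤y = ∈±-neg⁻¹ (subst (_∈± z · w) (solve 2 (λ x y → :- x :* y := :- (x :* y)) refl x y)
    (∈±-*-nonNeg (x≤0⇒0≤-x x≤0) 0≤y (proj₁ (∈±-neg bx)) (proj₁ by)))
  ... | inj₂ x≤0 | inj₂ y≤0 = subst (_∈± z · w) (solve 2 (λ x y → :- x :* :- y := x :* y) refl x y)
    (∈±-*-nonNeg (x≤0⇒0≤-x x≤0) (x≤0⇒0≤-x y≤0) (proj₁ (∈±-neg bx)) (proj₁ (∈±-neg by)))

  x∈±∣x∣ : ∀ x → x ∈± ∣ x ∣
  x∈±∣x∣ x with ≤-total 𝟘 x
  ... | inj₁ 0≤x = ∈±-self 0≤x
  ... | inj₂ x≤0 = ∈±-neg⁻¹ (∈±-self (x≤0⇒0≤-x x≤0))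

  ∣x∣-nonNeg : ∀ x → 𝟘 ≤ ∣ x ∣
  ∣x∣-nonNeg x = ∈±-nonNeg (x∈±∣x∣ x)

  ∣x∣≤e⇒x∈±e : ∣ x ∣ ≤ z → x ∈± z
  ∣x∣≤e⇒x∈±e {x} = ∈±-mono (x∈±∣x∣ x)

  0≤x⇒∣x∣≡x : 𝟘 ≤ x → ∣ x ∣ ≡ x
  0≤x⇒∣x∣≡x {x} 0≤x with ≤-total 𝟘 x
  ... | inj₁ _   = refl
  ... | inj₂ x≤0 = trans (cong -_ x≡0) (trans -0#≈0# (sym x≡0))
    where x≡0 = ≤-antisym x≤0 0≤x

  x≤0⇒∣x∣≡-x : x ≤ 𝟘 → ∣ x ∣ ≡ - x
  x≤0⇒∣x∣≡-x {x} x≤0 with ≤-total 𝟘 x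
  ... | inj₂ _   = refl
  ... | inj₁ 0≤x = trans x≡0 (trans (sym -0#≈0#) (cong -_ (sym x≡0)))
    where x≡0 = ≤-antisym x≤0 0≤x

  infix 4 _∈[_,_]
  _∈[_,_] : M → M → M → Set
  x ∈[ a , b ] = a ≤ x × x ≤ b

  small-positive : ∀ {δ c} → 𝟘 ≺ δ → 𝟘 ≺ c → Σ M λ t → 𝟘 ≺ t × t ≺ δ × t ≤ c
  small-positive {δ} {c} 0≺δ 0≺c =
    (half · δ) ⊓ c , ⊓-pos (half-pos 0≺δ) 0≺c , ≤-≺-trans (x⊓y≤x _ _) (half≺ 0≺δ) , x⊓y≤y _ _

module Derivatives (S : OrderedFieldExp) where

  open OrderedFieldProperties S

  private variable
    f g : M → M
    a d e : M

  TangentWithin : (M → M) → M → M → M → M → Set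
  TangentWithin f a d t b = f (a + t) - f a - d · t ∈± b × f (a - t) - f a + d · t ∈± b

  -- `HasDerivativeAt` with the difference quotient multiplied out.
  record HasDerivativeAt′ (f : M → M) (a d : M) : Set where
    field
      tangent : ∀ ε → 𝟘 ≺ ε →
                Σ M λ δ → 𝟘 ≺ δ × (∀ t → 𝟘 ≺ t → t ≺ δ → TangentWithin f a d t (ε · t))

  open HasDerivativeAt′ public

  private
    quotient-multiplied-out : ∀ {F h ε} → h ≢ 𝟘 → ∣ F · h ⁻¹ - d ∣ < ε → F - d · h ∈± ε · ∣ h ∣
    quotient-multiplied-out {d} {F} {h} {ε} h≢0 close =
      subst (_∈± ε · ∣ h ∣) multiplied (∈±-* (∣x∣≤e⇒x∈±e (proj₁ close)) (x∈±∣x∣ h))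
      where
      open ≡-Reasoning
      multiplied : (F · h ⁻¹ - d) · h ≡ F - d · h
      multiplied = begin
        (F · h ⁻¹ - d) · h
          ≡⟨ solve 4 (λ F h h⁻¹ d → (F :* h⁻¹ :- d) :* h := F :* (h :* h⁻¹) :- d :* h) refl F h (h ⁻¹) d ⟩
        F · (h · h ⁻¹) - d · h ≡⟨ cong (λ u → F · u - d · h) (⁻¹-inverse h h≢0) ⟩
        F · 𝟙 - d · h          ≡⟨ cong (_- d · h) (*-identityʳ F) ⟩
        F - d · h              ∎

  HasDerivativeAt⇒HasDerivativeAt′ : HasDerivativeAt S f a d → HasDerivativeAt′ f a d
  HasDerivativeAt⇒HasDerivativeAt′ {f} {a} {d} D .tangent ε 0≺ε with D ε (≺⇒< 0≺ε)
  ... | δ , 0<δ , close = δ , <⇒≺ 0<δ , λ t 0≺t t≺δ → right t 0≺t t≺δ , left t 0≺t t≺δ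
    where
    right : ∀ t → 𝟘 ≺ t → t ≺ δ → f (a + t) - f a - d · t ∈± ε · t
    right t 0≺t t≺δ = subst (λ u → f (a + t) - f a - d · t ∈± ε · u) ∣t∣≡t
      (quotient-multiplied-out (≺⇒≢ 0≺t ∘ sym)
        (close t (subst (𝟘 <_) (sym ∣t∣≡t) (≺⇒< 0≺t)) (subst (_< δ) (sym ∣t∣≡t) (≺⇒< t≺δ))))
      where ∣t∣≡t = 0≤x⇒∣x∣≡x (≺⇒≤ 0≺t)
    left : ∀ t → 𝟘 ≺ t → t ≺ δ → f (a - t) - f a + d · t ∈± ε · t
    left t 0≺t t≺δ =
      subst₂ _∈±_ (solve 3 (λ F d t → F :- d :* (:- t) := F :+ d :* t) refl (f (a - t) - f a) d t) (cong (ε ·_) ∣-t∣≡t)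
      (quotient-multiplied-out (≺⇒≢ (0≺x⇒-x≺0 0≺t))
        (close (- t) (subst (𝟘 <_) (sym ∣-t∣≡t) (≺⇒< 0≺t)) (subst (_< δ) (sym ∣-t∣≡t) (≺⇒< t≺δ))))
      where ∣-t∣≡t = trans (x≤0⇒∣x∣≡-x (≺⇒≤ (0≺x⇒-x≺0 0≺t))) (-‿involutive t)

  HasDerivativeAt′-transfer : ∀ {b c} → HasDerivativeAt′ f a d →
    (∀ t r → TangentWithin f a d t r → TangentWithin g b c t r) → HasDerivativeAt′ g b c
  HasDerivativeAt′-transfer D transfer .tangent ε 0≺ε =
    let (δ , 0≺δ , tangent-d) = tangent D ε 0≺ε
    in δ , 0≺δ , λ t 0≺t t≺δ → transfer t (ε · t) (tangent-d t 0≺t t≺δ)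

  derivative-+-linear : ∀ c → HasDerivativeAt′ f a d → HasDerivativeAt′ (λ x → f x + c · x) a (d + c)
  derivative-+-linear {f} {a} {d} c D = HasDerivativeAt′-transfer D λ t r (right , left) →
    subst (_∈± r) (solve 6 (λ A F d c a t → A :- F :- d :* t := A :+ c :* (a :+ t) :- (F :+ c :* a) :- (d :+ c) :* t)
                     refl (f (a + t)) (f a) d c a t) right ,
    subst (_∈± r) (solve 6 (λ A F d c a t → A :- F :+ d :* t := A :+ c :* (a :- t) :- (F :+ c :* a) :+ (d :+ c) :* t)
                     refl (f (a - t)) (f a) d c a t) left

  derivative-neg : HasDerivativeAt′ f a d → HasDerivativeAt′ (λ x → - f x) a (- d)
  derivative-neg {f} {a} {d} D = HasDerivativeAt′-transfer D λ t r (right , left) →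
    subst (_∈± r) (solve 4 (λ A F d t → :- (A :- F :- d :* t) := :- A :- :- F :- :- d :* t)
                     refl (f (a + t)) (f a) d t) (∈±-neg right) ,
    subst (_∈± r) (solve 4 (λ A F d t → :- (A :- F :+ d :* t) := :- A :- :- F :+ :- d :* t)
                     refl (f (a - t)) (f a) d t) (∈±-neg left)

  derivative-reflect : ∀ c → HasDerivativeAt′ g (c - a) e → HasDerivativeAt′ (λ x → g (c - x)) a (- e)
  derivative-reflect {g} {a} {e} c D = HasDerivativeAt′-transfer D λ t r (right , left) →
    subst (_∈± r) (reflected-right t) left , subst (_∈± r) (reflected-left t) right
    where
    reflected-right : ∀ t → g (c - a - t) - g (c - a) + e · t ≡ g (c - (a + t)) - g (c - a) - (- e) · t
    reflected-right t = cong₂ (λ u v → g u - g (c - a) + v)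
      (solve 3 (λ c a t → c :- a :- t := c :- (a :+ t)) refl c a t) (solve 2 (λ e t → e :* t := :- (:- e :* t)) refl e t)
    reflected-left : ∀ t → g (c - a + t) - g (c - a) - e · t ≡ g (c - (a - t)) - g (c - a) + (- e) · t
    reflected-left t = cong₂ (λ u v → g u - g (c - a) + v)
      (solve 3 (λ c a t → c :- a :+ t := c :- (a :- t)) refl c a t) (solve 2 (λ e t → :- (e :* t) := :- e :* t) refl e t)

  private
    -- With u = A - F - p and v = B - G - q the identity behind this bound is
    -- A B - F G - (p G + F q) = u G + F v + (p + u) (q + v).
    product-remainder : ∀ {A B F G p q r P Q} → p ∈± P → q ∈± Q → A - F - p ∈± r → B - G - q ∈± r →
      A · B - F · G - (p · G + F · q) ∈± r · ∣ G ∣ + ∣ F ∣ · r + (P + r) · (Q + r)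
    product-remainder {A} {B} {F} {G} {p} {q} {r} {P} {Q} bp bq bu bv =
      subst (_∈± r · ∣ G ∣ + ∣ F ∣ · r + (P + r) · (Q + r))
        (solve 6 (λ A B F G p q → (A :- F :- p) :* G :+ F :* (B :- G :- q)
                                    :+ (p :+ (A :- F :- p)) :* (q :+ (B :- G :- q))
                                  := A :* B :- F :* G :- (p :* G :+ F :* q)) refl A B F G p q)
        (∈±-+ (∈±-+ (∈±-* bu (x∈±∣x∣ G)) (∈±-* (x∈±∣x∣ F) bv)) (∈±-* (∈±-+ bp bu) (∈±-+ bq bv)))

    -- The two bounds on η and t each make one group of terms at most ε t / 2.
    product-remainder-bound : ∀ {F G D E η t ε} → 𝟘 ≤ F → 𝟘 ≤ G → 𝟘 ≤ D → 𝟘 ≤ E → 𝟘 ≤ η → 𝟘 ≤ t →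
      η ≤ 𝟙 → η ≤ half · ε · (G + F + 𝟙) ⁻¹ → t ≤ half · ε · ((D + 𝟙) · (E + 𝟙)) ⁻¹ →
      η · t · G + F · (η · t) + (D · t + η · t) · (E · t + η · t) ≤ ε · t
    product-remainder-bound {F} {G} {D} {E} {η} {t} {ε} 0≤F 0≤G 0≤D 0≤E 0≤η 0≤t η≤1 η≤ t≤ = begin
      η · t · G + F · (η · t) + (D · t + η · t) · (E · t + η · t)
        ≡⟨ solve 6 (λ F G D E η t → η :* t :* G :+ F :* (η :* t) :+ (D :* t :+ η :* t) :* (E :* t :+ η :* t)
                                    := η :* (G :+ F) :* t :+ (D :+ η) :* (E :+ η) :* t :* t) refl F G D E η t ⟩
      η · (G + F) · t + (D + η) · (E + η) · t · t
        ≤⟨ +-mono-≤ (*-monoˡ-≤-nonNeg 0≤t first) (*-monoˡ-≤-nonNeg 0≤t second) ⟩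
      half · ε · t + half · ε · t
        ≡⟨ solve 3 (λ h ε t → h :* ε :* t :+ h :* ε :* t := h :* (ε :* t) :+ h :* (ε :* t)) refl half ε t ⟩
      half · (ε · t) + half · (ε · t)
        ≡⟨ half+half (ε · t) ⟩
      ε · t ∎
      where
      open ≤-Reasoning
      0≤G+F = 0≤x+y 0≤G 0≤F
      0≺K : 𝟘 ≺ (D + 𝟙) · (E + 𝟙)
      0≺K = *-pos (0≤x⇒0≺x+1 0≤D) (0≤x⇒0≺x+1 0≤E)
      first : η · (G + F) ≤ half · ε
      first = ≤-trans (*-monoʳ-≤-nonNeg 0≤η (x≤x+y 0≤1))
                      (x≤y·z⁻¹⇒x·z≤y (0≤x⇒0≺x+1 0≤G+F) η≤)
      second : (D + η) · (E + η) · t ≤ half · ε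
      second = begin
        (D + η) · (E + η) · t         ≤⟨ *-monoˡ-≤-nonNeg 0≤t (*-mono-≤-nonNeg (0≤x+y 0≤D 0≤η) (0≤x+y 0≤E 0≤η)
                                                                          (+-monoʳ-≤ D η≤1) (+-monoʳ-≤ E η≤1)) ⟩
        (D + 𝟙) · (E + 𝟙) · t         ≤⟨ *-monoʳ-≤-nonNeg (≺⇒≤ 0≺K) t≤ ⟩
        (D + 𝟙) · (E + 𝟙) · (half · ε · ((D + 𝟙) · (E + 𝟙)) ⁻¹)
                                      ≡⟨ trans (*-comm _ _) (x·y⁻¹·y≡x 0≺K) ⟩
        half · ε                      ∎

  derivative-· : HasDerivativeAt′ f a d → HasDerivativeAt′ g a e →
                 HasDerivativeAt′ (λ x → f x · g x) a (d · g a + f a · e)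
  derivative-· {f} {a} {d} {g} {e} Df Dg .tangent ε 0≺ε =
    let (δf , 0≺δf , tangent-f) = tangent Df η 0≺η
        (δg , 0≺δg , tangent-g) = tangent Dg η 0≺η
    in δf ⊓ (δg ⊓ δ₃) , ⊓-pos 0≺δf (⊓-pos 0≺δg 0≺δ₃) , λ t 0≺t t≺δ →
       product-tangent 0≺t (≺⇒≤ (≺-≤-trans t≺δ (≤-trans (x⊓y≤y _ _) (x⊓y≤y _ _))))
         (tangent-f t 0≺t (≺-≤-trans t≺δ (x⊓y≤x _ _)))
         (tangent-g t 0≺t (≺-≤-trans t≺δ (≤-trans (x⊓y≤y _ _) (x⊓y≤x _ _))))
    where
    F = ∣ f a ∣
    G = ∣ g a ∣
    D = ∣ d ∣
    E = ∣ e ∣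
    η = 𝟙 ⊓ (half · ε · (G + F + 𝟙) ⁻¹)
    0≺η : 𝟘 ≺ η
    0≺η = ⊓-pos 0≺1 (*-pos (half-pos 0≺ε) (⁻¹-pos (0≤x⇒0≺x+1 (0≤x+y (∣x∣-nonNeg (g a)) (∣x∣-nonNeg (f a))))))
    δ₃ = half · ε · ((D + 𝟙) · (E + 𝟙)) ⁻¹
    0≺δ₃ : 𝟘 ≺ δ₃
    0≺δ₃ = *-pos (half-pos 0≺ε) (⁻¹-pos (*-pos (0≤x⇒0≺x+1 (∣x∣-nonNeg d)) (0≤x⇒0≺x+1 (∣x∣-nonNeg e))))
    plus-as-minus : ∀ A F p → A - F + p ≡ A - F - - p
    plus-as-minus = solve 3 (λ A F p → A :- F :+ p := A :- F :- :- p) refl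

    product-tangent : ∀ {t} → 𝟘 ≺ t → t ≤ δ₃ → TangentWithin f a d t (η · t) → TangentWithin g a e t (η · t) →
                      TangentWithin (λ x → f x · g x) a (d · g a + f a · e) t (ε · t)
    product-tangent {t} 0≺t t≤δ₃ (right-f , left-f) (right-g , left-g) =
      subst (_∈± ε · t) (solve 7 (λ A B F G d e t → A :* B :- F :* G :- (d :* t :* G :+ F :* (e :* t))
                                                 := A :* B :- F :* G :- (d :* G :+ F :* e) :* t) refl
                                    (f (a + t)) (g (a + t)) (f a) (g a) d e t)
        (∈±-mono (product-remainder dt∈±Dt et∈±Et right-f right-g) bound) ,
      subst (_∈± ε · t) (solve 7 (λ A B F G d e t → A :* B :- F :* G :- (:- (d :* t) :* G :+ F :* :- (e :* t))
                                                 := A :* B :- F :* G :+ (d :* G :+ F :* e) :* t) refl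
                                    (f (a - t)) (g (a - t)) (f a) (g a) d e t)
        (∈±-mono (product-remainder (∈±-neg dt∈±Dt) (∈±-neg et∈±Et)
                    (subst (_∈± η · t) (plus-as-minus (f (a - t)) (f a) (d · t)) left-f)
                    (subst (_∈± η · t) (plus-as-minus (g (a - t)) (g a) (e · t)) left-g)) bound)
      where
      dt∈±Dt = ∈±-* (x∈±∣x∣ d) (∈±-self (≺⇒≤ 0≺t))
      et∈±Et = ∈±-* (x∈±∣x∣ e) (∈±-self (≺⇒≤ 0≺t))
      bound = product-remainder-bound (∣x∣-nonNeg (f a)) (∣x∣-nonNeg (g a)) (∣x∣-nonNeg d) (∣x∣-nonNeg e)
                (≺⇒≤ 0≺η) (≺⇒≤ 0≺t) (x⊓y≤x _ _) (x⊓y≤y _ _) t≤δ₃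

  LocallyIncreasingAt : (M → M) → M → Set
  LocallyIncreasingAt f a = Σ M λ δ → 𝟘 ≺ δ ×
    (∀ x → a - δ ≺ x → x ≺ a → f x ≺ f a) × (∀ x → a ≺ x → x ≺ a + δ → f a ≺ f x)

  derivative-pos⇒locally-increasing : HasDerivativeAt′ f a d → 𝟘 ≺ d → LocallyIncreasingAt f a
  derivative-pos⇒locally-increasing {f} {a} {d} D 0≺d =
    let (δ , 0≺δ , tangent-d) = tangent D (half · d) (half-pos 0≺d) in
    δ , 0≺δ ,
    (λ x a-δ≺x x≺a → subst (λ y → f y ≺ f a) (x-[x-y]≡y a x)
       (left-increase (x≺y⇒0≺y-x x≺a) (proj₂ (tangent-d (a - x) (x≺y⇒0≺y-x x≺a) (x-z≺y⇒x-y≺z a-δ≺x))))) ,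
    (λ x a≺x x≺a+δ → subst (λ y → f a ≺ f y) (x+[y-x]≡y a x)
       (right-increase (x≺y⇒0≺y-x a≺x) (proj₁ (tangent-d (x - a) (x≺y⇒0≺y-x a≺x) (y≺x+z⇒y-x≺z x≺a+δ)))))
    where
    ½dt≺dt : ∀ {t} → 𝟘 ≺ t → half · d · t ≺ d · t
    ½dt≺dt {t} 0≺t = subst (_≺ d · t) (sym (*-assoc half d t)) (half≺ (*-pos 0≺d 0≺t))
    left-increase : ∀ {t} → 𝟘 ≺ t → f (a - t) - f a + d · t ∈± half · d · t → f (a - t) ≺ f a
    left-increase {t} 0≺t (upper , _) = ≺-by-difference
      (solve 3 (λ A F p → F :- A := p :- (A :- F :+ p)) refl (f (a - t)) (f a) (d · t))
      (≤-≺-trans upper (½dt≺dt 0≺t))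
    right-increase : ∀ {t} → 𝟘 ≺ t → f (a + t) - f a - d · t ∈± half · d · t → f a ≺ f (a + t)
    right-increase {t} 0≺t (_ , lower) = ≺-by-difference
      (solve 3 (λ A F p → A :- F := A :- F :- p :- :- p) refl (f (a + t)) (f a) (d · t))
      (≺-≤-trans (neg-antimono-≺ (½dt≺dt 0≺t)) lower)

  derivative⇒step-within : ∀ {η} → HasDerivativeAt′ f a d → 𝟘 ≺ η →
    Σ M λ t → 𝟘 ≺ t × f (a + t) - f a ∈± η × f (a - t) - f a ∈± η
  derivative⇒step-within {f} {a} {d} {η} D 0≺η =
    let (δ , 0≺δ , tangent-d) = tangent D 𝟙 0≺1
        (t , 0≺t , t≺δ , t≤η/K) = small-positive 0≺δ (*-pos 0≺η (⁻¹-pos 0≺K))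
        (right , left) = tangent-d t 0≺t t≺δ
        dt∈±Dt = ∈±-* (x∈±∣x∣ d) (∈±-self (≺⇒≤ 0≺t))
    in
    t , 0≺t ,
    ∈±-mono (subst (_∈± 𝟙 · t + ∣ d ∣ · t) (cancel-right (f (a + t)) (f a) (d · t)) (∈±-+ right dt∈±Dt))
            (Kt≤η t≤η/K) ,
    ∈±-mono (subst (_∈± 𝟙 · t + ∣ d ∣ · t) (cancel-left (f (a - t)) (f a) (d · t)) (∈±-+ left (∈±-neg dt∈±Dt)))
            (Kt≤η t≤η/K)
    where
    K = ∣ d ∣ + 𝟙
    0≺K : 𝟘 ≺ K
    0≺K = 0≤x⇒0≺x+1 (∣x∣-nonNeg d)
    cancel-right : ∀ A F p → A - F - p + p ≡ A - F
    cancel-right = solve 3 (λ A F p → A :- F :- p :+ p := A :- F) refl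
    cancel-left : ∀ A F p → A - F + p + - p ≡ A - F
    cancel-left = solve 3 (λ A F p → A :- F :+ p :+ :- p := A :- F) refl
    Kt≤η : ∀ {t} → t ≤ η · K ⁻¹ → 𝟙 · t + ∣ d ∣ · t ≤ η
    Kt≤η {t} t≤η/K = begin
      𝟙 · t + ∣ d ∣ · t   ≡⟨ solve 3 (λ o t D → o :* t :+ D :* t := (D :+ o) :* t) refl 𝟙 t ∣ d ∣ ⟩
      K · t               ≤⟨ *-monoʳ-≤-nonNeg (≺⇒≤ 0≺K) t≤η/K ⟩
      K · (η · K ⁻¹)      ≡⟨ trans (*-comm K _) (x·y⁻¹·y≡x 0≺K) ⟩
      η                   ∎
      where open ≤-Reasoning

module DefinableCompleteness (em : ExcludedMiddle 0ℓ) (S : OrderedFieldExp) (complete : DefinablyComplete S) where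

  open OrderedFieldProperties S
  open Derivatives S
  open Language S

  private variable
    f : M → M
    a b x y : M
    P : M → Set

  ≤⇒≡⊎≺ : x ≤ y → x ≡ y ⊎ x ≺ y
  ≤⇒≡⊎≺ {x} {y} x≤y with em {x ≡ y}
  ... | yes x≡y = inj₁ x≡y
  ... | no  x≢y = inj₂ (≤∧≢⇒≺ x≤y x≢y)

  ≺-mono⇒≤-mono : ∀ {g : M → M} → (x ≺ y → g x ≺ g y) → x ≤ y → g x ≤ g y
  ≺-mono⇒≤-mono {g = g} mono x≤y = [ (λ x≡y → ≤-reflexive (cong g x≡y)) , ≺⇒≤ ∘ mono ]′ (≤⇒≡⊎≺ x≤y)

  IsSup : (M → Set) → M → Set
  IsSup P s = (∀ x → P x → x ≤ s) × (∀ b → (∀ x → P x → x ≤ b) → s ≤ b)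

  sup-approx : ∀ {s δ} → IsSup P s → 𝟘 ≺ δ → Σ M λ x → P x × s - δ ≺ x
  sup-approx {s = s} {δ} (_ , least) 0≺δ =
    em⇒dne em λ none → x-y≺x 0≺δ (least (s - δ) λ x Px → em⇒dne em λ s-δ≺x → none (x , Px , s-δ≺x))

  sup-of-definable : (φ : Formula 1) → (∀ x → P x → x ∈⟦ φ ⟧) → (∀ x → x ∈⟦ φ ⟧ → P x) →
                     Σ M P → Σ M (λ b → ∀ x → P x → x ≤ b) → Σ M (IsSup P)
  sup-of-definable φ to from (x , Px) (b , bound) with complete φ (x , to x Px) (b , λ y → bound y ∘ from y)
  ... | s , upper , least = s , (λ y → upper y ∘ to y) , (λ c bound′ → least c λ y → bound′ y ∘ from y)

  -- f is computed by a term with parameters, so conditions on values of f are first-order.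
  record TermDefinable (f : M → M) : Set where
    field
      term   : ∀ {n} → Term n → Term n
      ⟦term⟧ : ∀ {n} (t : Term n) (ρ : Env n) → ⟦ term t ⟧ₜ ρ ≡ f (⟦ t ⟧ₜ ρ)

  open TermDefinable

  neg-definable : TermDefinable f → TermDefinable (λ x → - f x)
  neg-definable {f} df .term t = param (- 𝟙) ⊗ term df t
  neg-definable {f} df .⟦term⟧ t ρ =
    trans (cong (- 𝟙 ·_) (⟦term⟧ df t ρ)) (solve 1 (λ y → :- con (+ 1) :* y := :- y) refl _)

  +-linear-definable : ∀ c → TermDefinable f → TermDefinable (λ x → f x + c · x)
  +-linear-definable c df .term t = term df t ⊕ (param c ⊗ t)
  +-linear-definable c df .⟦term⟧ t ρ = cong (_+ c · ⟦ t ⟧ₜ ρ) (⟦term⟧ df t ρ)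

  ·-definable : ∀ {g} → TermDefinable f → TermDefinable g → TermDefinable (λ x → f x · g x)
  ·-definable df dg .term t = term df t ⊗ term dg t
  ·-definable df dg .⟦term⟧ t ρ = cong₂ _·_ (⟦term⟧ df t ρ) (⟦term⟧ dg t ρ)

  reflect-definable : ∀ {g} c → TermDefinable g → TermDefinable (λ x → g (c - x))
  reflect-definable c dg .term t = term dg (param c ⊕ (param (- 𝟙) ⊗ t))
  reflect-definable {g} c dg .⟦term⟧ t ρ =
    trans (⟦term⟧ dg _ ρ) (cong g (solve 2 (λ c x → c :+ :- con (+ 1) :* x := c :- x) refl c (⟦ t ⟧ₜ ρ)))

  exp-definable : TermDefinable exp
  exp-definable .term = texp
  exp-definable .⟦term⟧ t ρ = refl

  module _ (df : TermDefinable f) (a≺b : a ≺ b) (increasing : ∀ x → x ∈[ a , b ] → LocallyIncreasingAt f x) where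

    private
      AboveOn : M → Set
      AboveOn x = x ∈[ a , b ] × (∀ y → y ∈[ a , x ] → f a ≤ f y)

      φ : Formula 1
      φ = ((param a ≼ var zero) ∧' (var zero ≼ param b)) ∧'
          ∀' (((param a ≼ var zero) ∧' (var zero ≼ var (suc zero))) ⇒ (param (f a) ≼ term df (var zero)))

      a-AboveOn : AboveOn a
      a-AboveOn = (≤-refl a , ≺⇒≤ a≺b) , λ y (a≤y , y≤a) → ≤-reflexive (cong f (≤-antisym a≤y y≤a))

      sup : Σ M (IsSup AboveOn)
      sup = sup-of-definable φ
        (λ x (x∈[a,b] , above) → x∈[a,b] , λ y y∈[a,x] → subst (f a ≤_) (sym (⟦term⟧ df (var zero) _)) (above y y∈[a,x]))
        (λ x (x∈[a,b] , above) → x∈[a,b] , λ y y∈[a,x] → subst (f a ≤_) (⟦term⟧ df (var zero) _) (above y y∈[a,x]))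
        (a , a-AboveOn) (b , λ x → proj₂ ∘ proj₁)

    private module AtSupremum (s : M) (s-sup : IsSup AboveOn s) where
      s-upper = proj₁ s-sup
      s-least = proj₂ s-sup

      s∈[a,b] : s ∈[ a , b ]
      s∈[a,b] = s-upper a a-AboveOn , s-least b (λ x → proj₂ ∘ proj₁)

      fa≤f : AboveOn x → f a ≤ f x
      fa≤f {x} ((a≤x , _) , above) = above x (a≤x , ≤-refl x)

      fa≤fs : f a ≤ f s
      fa≤fs =
        let (δ , 0≺δ , left-of-s , _) = increasing s s∈[a,b]
            (x , x-AboveOn , s-δ≺x) = sup-approx s-sup 0≺δ
        in ≤-trans (fa≤f x-AboveOn) (≺-mono⇒≤-mono {g = f} (left-of-s x s-δ≺x) (s-upper x x-AboveOn))

      fa≤f-below-s : a ≤ y → y ≺ s → f a ≤ f y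
      fa≤f-below-s {y} a≤y y≺s =
        let (x , (_ , above-x) , s-[s-y]≺x) = sup-approx s-sup (x≺y⇒0≺y-x y≺s)
        in above-x y (a≤y , ≺⇒≤ (subst (_≺ x) (x-[x-y]≡y s y) s-[s-y]≺x))

      s-AboveOn : AboveOn s
      s-AboveOn = s∈[a,b] , λ y (a≤y , y≤s) →
        [ (λ y≡s → subst (λ z → f a ≤ f z) (sym y≡s) fa≤fs) , fa≤f-below-s a≤y ]′ (≤⇒≡⊎≺ y≤s)

      b≤s : b ≤ s
      b≤s = em⇒dne em λ s≺b →
        let (δ , 0≺δ , _ , right-of-s) = increasing s s∈[a,b]
            (t , 0≺t , t≺δ , t≤b-s) = small-positive 0≺δ (x≺y⇒0≺y-x s≺b)
            above : ∀ y → y ∈[ a , s + t ] → f a ≤ f y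
            above y (a≤y , y≤s+t) = [ (λ y≤s → proj₂ s-AboveOn y (a≤y , y≤s))
                                    , (λ s≤y → ≤-trans fa≤fs (≺-mono⇒≤-mono {g = f}
                                         (λ s≺y → right-of-s y s≺y (≤-≺-trans y≤s+t (+-monoʳ-≺ s t≺δ))) s≤y)) ]′ (≤-total y s)
            s+t≤b = ≤-by-difference (solve 3 (λ b s t → b :- (s :+ t) := b :- s :- t) refl b s t) t≤b-s
        in x≺x+y 0≺t (s-upper (s + t) ((≤-trans (proj₁ s∈[a,b]) (x≤x+y (≺⇒≤ 0≺t)) , s+t≤b) , above))

    locally-increasing⇒increasing : f a ≺ f b
    locally-increasing⇒increasing =
      let (δ , 0≺δ , left-of-b , _) = increasing b (≺⇒≤ a≺b , ≤-refl b)
          (t , 0≺t , t≺δ , t≤b-a) = small-positive 0≺δ (x≺y⇒0≺y-x a≺b)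
          above-b = proj₂ (subst AboveOn (≤-antisym (proj₂ s∈[a,b]) b≤s) s-AboveOn)
          a≤b-t = ≤-by-difference (solve 3 (λ a b t → b :- t :- a := b :- a :- t) refl a b t) t≤b-a
          b-δ≺b-t = ≺-by-difference (solve 3 (λ b t δ → b :- t :- (b :- δ) := δ :- t) refl b t δ) t≺δ
      in ≤-≺-trans (above-b (b - t) (a≤b-t , x-y≤x (≺⇒≤ 0≺t))) (left-of-b (b - t) b-δ≺b-t (x-y≺x 0≺t))
      where open AtSupremum (proj₁ sup) (proj₂ sup)

  derivative-nonNeg⇒monotone : TermDefinable f → a ≤ b →
    (∀ x → x ∈[ a , b ] → Σ M λ d → 𝟘 ≤ d × HasDerivativeAt′ f x d) → f a ≤ f b
  derivative-nonNeg⇒monotone {f} {a} {b} df a≤b derivative = em⇒dne em λ fb≺fa →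
    [ (λ a≡b → fb≺fa (≤-reflexive (cong f a≡b))) , (λ a≺b → tilted a≺b fb≺fa) ]′ (≤⇒≡⊎≺ a≤b)
    where
    -- f x + ε x with ε (b - a) = (f a - f b) / 2 has positive derivative, yet still decreases from a to b.
    tilted : a ≺ b → f b ≺ f a → ⊥
    tilted a≺b fb≺fa = locally-increasing⇒increasing (+-linear-definable ε df) a≺b increasing
                         (≤-by-difference gap (≺⇒≤ (half-pos 0≺Δ)))
      where
      Δ = f a - f b
      L = b - a
      0≺Δ = x≺y⇒0≺y-x fb≺fa
      0≺L = x≺y⇒0≺y-x a≺b
      ε = half · Δ · L ⁻¹
      0≺ε : 𝟘 ≺ ε
      0≺ε = *-pos (half-pos 0≺Δ) (⁻¹-pos 0≺L)
      increasing : ∀ x → x ∈[ a , b ] → LocallyIncreasingAt (λ x → f x + ε · x) x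
      increasing x x∈[a,b] =
        let (d , 0≤d , D) = derivative x x∈[a,b]
        in derivative-pos⇒locally-increasing (derivative-+-linear ε D) (0≺x+y 0≤d 0≺ε)
      gap : f a + ε · a - (f b + ε · b) ≡ half · Δ - 𝟘
      gap = begin
        f a + ε · a - (f b + ε · b)
          ≡⟨ solve 5 (λ A B ε a b → A :+ ε :* a :- (B :+ ε :* b) := A :- B :- ε :* (b :- a)) refl (f a) (f b) ε a b ⟩
        Δ - ε · L                         ≡⟨ cong (λ u → Δ - u) (x·y⁻¹·y≡x 0≺L) ⟩
        Δ - half · Δ                      ≡⟨ cong (_- half · Δ) (half+half Δ) ⟨
        half · Δ + half · Δ - half · Δ    ≡⟨ solve 1 (λ h → h :+ h :- h := h :- con (+ 0)) refl (half · Δ) ⟩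
        half · Δ - 𝟘                      ∎
        where open ≡-Reasoning

  derivative-nonPos⇒antitone : TermDefinable f → a ≤ b →
    (∀ x → x ∈[ a , b ] → Σ M λ d → d ≤ 𝟘 × HasDerivativeAt′ f x d) → f b ≤ f a
  derivative-nonPos⇒antitone df a≤b derivative =
    subst₂ _≤_ (-‿involutive _) (-‿involutive _) (neg-antimono-≤
      (derivative-nonNeg⇒monotone (neg-definable df) a≤b λ x x∈[a,b] →
        let (d , d≤0 , D) = derivative x x∈[a,b] in - d , x≤0⇒0≤-x d≤0 , derivative-neg D))

  derivative-zero⇒constant : TermDefinable f → (∀ x → HasDerivativeAt′ f x 𝟘) → ∀ x y → f x ≡ f y
  derivative-zero⇒constant {f} df D x y = [ constant-on , sym ∘ constant-on ]′ (≤-total x y)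
    where
    constant-on : ∀ {x y} → x ≤ y → f x ≡ f y
    constant-on x≤y = ≤-antisym (derivative-nonNeg⇒monotone df x≤y λ z _ → 𝟘 , ≤-refl 𝟘 , D z)
                                (derivative-nonPos⇒antitone df x≤y λ z _ → 𝟘 , ≤-refl 𝟘 , D z)

module Exponential (em : ExcludedMiddle 0ℓ) (S : OrderedFieldExp) (model : IsModelTdcExp S) where

  open OrderedFieldProperties S
  open Derivatives S
  open Language S
  open DefinableCompleteness em S (proj₁ model)

  exp-0 : exp 𝟘 ≡ 𝟙
  exp-0 = proj₂ (proj₂ model)

  exp-derivative : ∀ a → HasDerivativeAt′ exp a (exp a)
  exp-derivative a = HasDerivativeAt⇒HasDerivativeAt′ (proj₁ (proj₂ model) a)

  -- By the product rule x ↦ exp x · exp (c - x) has derivative exp x · exp (c - x) - exp x · exp (c - x) = 0.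
  exp-x·exp[c-x] : ∀ c x → exp x · exp (c - x) ≡ exp c
  exp-x·exp[c-x] c x =
    trans (derivative-zero⇒constant (·-definable exp-definable (reflect-definable c exp-definable)) derivative-zero x 𝟘) at-0
    where
    open ≡-Reasoning
    derivative-zero : ∀ a → HasDerivativeAt′ (λ x → exp x · exp (c - x)) a 𝟘
    derivative-zero a = subst (HasDerivativeAt′ _ a)
      (solve 2 (λ u v → u :* v :+ u :* :- v := con (+ 0)) refl (exp a) (exp (c - a)))
      (derivative-· (exp-derivative a) (derivative-reflect c (exp-derivative (c - a))))
    at-0 : exp 𝟘 · exp (c - 𝟘) ≡ exp c
    at-0 = begin
      exp 𝟘 · exp (c - 𝟘)   ≡⟨ cong₂ (λ u v → u · exp v) exp-0 (solve 1 (λ c → c :- con (+ 0) := c) refl c) ⟩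
      𝟙 · exp c             ≡⟨ *-identityˡ (exp c) ⟩
      exp c                 ∎

  exp-+ : ∀ x y → exp (x + y) ≡ exp x · exp y
  exp-+ x y = begin
    exp (x + y)                ≡⟨ exp-x·exp[c-x] (x + y) x ⟨
    exp x · exp (x + y - x)    ≡⟨ cong (λ u → exp x · exp u) (solve 2 (λ x y → x :+ y :- x := y) refl x y) ⟩
    exp x · exp y              ∎
    where open ≡-Reasoning

  exp-≢0 : ∀ x → exp x ≢ 𝟘
  exp-≢0 x exp-x≡0 = 𝟘≢𝟙 (begin
    𝟘                       ≡⟨ zeroˡ (exp (𝟘 - x)) ⟨
    𝟘 · exp (𝟘 - x)         ≡⟨ cong (_· exp (𝟘 - x)) exp-x≡0 ⟨
    exp x · exp (𝟘 - x)     ≡⟨ exp-x·exp[c-x] 𝟘 x ⟩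
    exp 𝟘                   ≡⟨ exp-0 ⟩
    𝟙                       ∎)
    where open ≡-Reasoning

  exp-pos : ∀ x → 𝟘 ≺ exp x
  exp-pos x = ≤∧≢⇒≺ (subst (𝟘 ≤_) (sym exp-x≡square) (x·x-nonNeg _)) (exp-≢0 x ∘ sym)
    where
    exp-x≡square : exp x ≡ exp (half · x) · exp (half · x)
    exp-x≡square = trans (cong exp (sym (half+half x))) (exp-+ _ _)

  exp-increasing : ∀ {x y} → x ≺ y → exp x ≺ exp y
  exp-increasing x≺y =
    locally-increasing⇒increasing exp-definable x≺y λ z _ → derivative-pos⇒locally-increasing (exp-derivative z) (exp-pos z)

  exp-monotone : ∀ {x y} → x ≤ y → exp x ≤ exp y
  exp-monotone = ≺-mono⇒≤-mono {g = exp} exp-increasing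

  -- exp x - x is smallest at 0: its derivative exp x - 1 has the sign of x.
  x+1≤exp : ∀ x → x + 𝟙 ≤ exp x
  x+1≤exp x = ≤-by-difference (solve 2 (λ e x → e :- (x :+ con (+ 1)) := e :+ :- con (+ 1) :* x :- con (+ 1)) refl (exp x) x)
                              (subst (_≤ g x) g-0 (g0≤g x))
    where
    g : M → M
    g x = exp x + (- 𝟙) · x
    g-definable : TermDefinable g
    g-definable = +-linear-definable (- 𝟙) exp-definable
    g-derivative : ∀ z → HasDerivativeAt′ g z (exp z + - 𝟙)
    g-derivative z = derivative-+-linear (- 𝟙) (exp-derivative z)
    g-0 : g 𝟘 ≡ 𝟙
    g-0 = trans (cong (_+ (- 𝟙) · 𝟘) exp-0) (solve 1 (λ o → o :+ :- o :* con (+ 0) := o) refl 𝟙)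
    g0≤g : ∀ x → g 𝟘 ≤ g x
    g0≤g x = [ (λ 0≤x → derivative-nonNeg⇒monotone g-definable 0≤x λ z (0≤z , _) →
                   exp z + - 𝟙 , x≤y⇒0≤y-x (subst (_≤ exp z) exp-0 (exp-monotone 0≤z)) , g-derivative z)
             , (λ x≤0 → derivative-nonPos⇒antitone g-definable x≤0 λ z (_ , z≤0) →
                   exp z + - 𝟙 , ≤-by-difference (solve 2 (λ o e → con (+ 0) :- (e :- o) := o :- e) refl 𝟙 (exp z))
                                                 (subst (exp z ≤_) exp-0 (exp-monotone z≤0)) , g-derivative z)
             ]′ (≤-total 𝟘 x)

  x≤exp : ∀ x → x ≤ exp x
  x≤exp x = ≤-trans (x≤x+y 0≤1) (x+1≤exp x)

  exp-sup≡y : ∀ {y s} → IsSup (λ x → exp x ≤ y) s → exp s ≡ y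
  exp-sup≡y {y} {s} (s-upper , s-least) = ≤-antisym (em⇒dne em not-above) (em⇒dne em not-below)
    where
    not-above : ¬ (y ≺ exp s)
    not-above y≺exp-s =
      let (t , 0≺t , _ , close-left) = derivative⇒step-within (exp-derivative s) (x≺y⇒0≺y-x y≺exp-s)
          y≤exp[s-t] = ≤-by-difference (solve 3 (λ A E y → A :- y := A :- E :- :- (E :- y)) refl (exp (s - t)) (exp s) y)
                                       (proj₂ close-left)
      in x-y≺x 0≺t (s-least (s - t) λ x exp-x≤y → em⇒dne em λ s-t≺x →
           exp-increasing s-t≺x (≤-trans exp-x≤y y≤exp[s-t]))
    not-below : ¬ (exp s ≺ y)
    not-below exp-s≺y =
      let (t , 0≺t , close-right , _) = derivative⇒step-within (exp-derivative s) (x≺y⇒0≺y-x exp-s≺y)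
          exp[s+t]≤y = ≤-by-difference (solve 3 (λ A E y → y :- A := y :- E :- (A :- E)) refl (exp (s + t)) (exp s) y)
                                       (proj₁ close-right)
      in x≺x+y 0≺t (s-upper (s + t) exp[s+t]≤y)

  exp-surjective : ∀ {y} → 𝟘 ≺ y → Σ M λ x → exp x ≡ y
  exp-surjective {y} 0≺y =
    let (s , s-sup) = sup-of-definable (texp (var zero) ≼ param y) (λ _ → id) (λ _ → id) (𝟘 - z , exp[-z]≤y) (y , below-y)
    in s , exp-sup≡y s-sup
    where
    open ≤-Reasoning
    z = y ⁻¹
    below-y : ∀ x → exp x ≤ y → x ≤ y
    below-y x exp-x≤y = ≤-trans (x≤exp x) exp-x≤y
    exp[-z]≤y : exp (𝟘 - z) ≤ y
    exp[-z]≤y = begin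
      exp (𝟘 - z)                 ≡⟨ *-identityˡ (exp (𝟘 - z)) ⟨
      𝟙 · exp (𝟘 - z)             ≡⟨ cong (_· exp (𝟘 - z)) (⁻¹-inverse y (0≺⇒≢0 0≺y)) ⟨
      y · z · exp (𝟘 - z)         ≡⟨ *-assoc y z (exp (𝟘 - z)) ⟩
      y · (z · exp (𝟘 - z))       ≤⟨ *-monoʳ-≤-nonNeg (≺⇒≤ 0≺y) (*-monoˡ-≤-nonNeg (≺⇒≤ (exp-pos _)) (x≤exp z)) ⟩
      y · (exp z · exp (𝟘 - z))   ≡⟨ cong (y ·_) (trans (exp-x·exp[c-x] 𝟘 z) exp-0) ⟩
      y · 𝟙                       ≡⟨ *-identityʳ y ⟩
      y                           ∎

proposition4p11 : ExcludedMiddle 0ℓ → (S : OrderedFieldExp) → IsModelTdcExp S →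
    let open OrderedFieldExp S in
      (∀ x y → x < y → exp x < exp y)
      × (∀ x → 𝟘 < exp x)
      × (∀ y → 𝟘 < y → Σ M λ x → exp x ≡ y)
      × (∀ x y → exp (x + y) ≡ exp x · exp y)
      × (∀ x → x + 𝟙 ≤ exp x)
proposition4p11 em S model =
  (λ x y x<y → ≺⇒< (exp-increasing (<⇒≺ x<y))) ,
  (λ x → ≺⇒< (exp-pos x)) ,
  (λ y 0<y → exp-surjective (<⇒≺ 0<y)) ,
  exp-+ ,
  x+1≤exp
  where
  open OrderedFieldProperties S
  open Exponential em S model
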